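{- Let $w\in\widetilde S_n$ and let $q$ be a positive integer with $q<n$. Then $\mathrm{maxr}(w)>q$ if and only if there exist $v_1,v_2\in\widetilde S_n$ and $S\subsetneq\mathbb Z/n\mathbb Z$ with $w=v_1d_Sv_2$, $\ell(w)=\ell(v_1)+\ell(v_2)+|S|$ and $|S|>q$. Similarly, $\mathrm{maxc}(w)>q$ if and only if $w=v_1u_Sv_2$ for some $v_1,v_2\in\widetilde S_n$ and $S\subsetneq\mathbb Z/n\mathbb Z$ with $\ell(w)=\ell(v_1)+\ell(v_2)+|S|$ and $|S|>q$.
   Context: $\widetilde S_n$ is the affine symmetric group with generators $s_i$, $i\in\mathbb Z/n\mathbb Z$, relations $s_i^2=1$, $s_is_{i+1}s_i=s_{i+1}s_is_{i+1}$, $s_is_j=s_js_i$ for $i-j\ne\pm1$ (indices mod $n$); $\ell$ is the length. For $J\subsetneq\mathbb Z/n\mathbb Z$, $d_J$ (resp. $u_J$) is the unique element which is a product of the $s_j$, $j\in J$, each exactly once, such that whenever $j,j+1\in J$, $s_{j+1}$ stands to the left of $s_j$ (resp. $s_j$ to the left of $s_{j+1}$). $\mathrm{maxr}(w)$ (resp. $\mathrm{maxc}(w)$) is the largest $|J|$ such that $w=vd_J$ (resp. $w=vu_J$) for some $v$ with $\ell(w)=\ell(v)+|J|$. -}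

module Defs where

open import Data.Nat using (ℕ; zero; suc; _+_; _<_; _≤_)
open import Data.Nat.DivMod using (_mod_)
open import Data.Fin using (Fin; toℕ)
open import Data.Fin.Subset using (Subset; ⊤; _⊂_; ∣_∣) renaming (_∈_ to _∈ₛ_)
open import Data.List using (List; []; _∷_; _++_; length)
open import Data.List.Membership.Propositional using (_∈_)
open import Data.List.Relation.Unary.Unique.Propositional using (Unique)
open import Data.Product using (Σ; ∃; _×_; _,_)
open import Relation.Binary.PropositionalEquality using (_≡_; _≢_)
open import Function.Bundles using (_⇔_)

-- Generators s_i of the affine symmetric group are indexed by i ∈ Z/nZ = Fin n.
-- An element is represented by a word: the list [a₁,…,a_k] stands for the
-- product s_{a₁} s_{a₂} ⋯ s_{a_k} (read left to right).
Word : ℕ → Set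
Word n = List (Fin n)

sucMod : ∀ {n} → Fin n → Fin n
sucMod {suc m} i = suc (toℕ i) mod (suc m)

data Rel {n : ℕ} : Word n → Word n → Set where
  quad  : ∀ i → Rel (i ∷ i ∷ []) []
  braid : ∀ i → Rel (i ∷ sucMod i ∷ i ∷ []) (sucMod i ∷ i ∷ sucMod i ∷ [])
  comm  : ∀ i j → j ≢ sucMod i → i ≢ sucMod j →
          Rel (i ∷ j ∷ []) (j ∷ i ∷ [])

-- equality in the affine symmetric group: the congruence generated by Rel
data _≈_ {n : ℕ} : Word n → Word n → Set where
  ≈-refl  : ∀ {u} → u ≈ u
  ≈-sym   : ∀ {u v} → u ≈ v → v ≈ u
  ≈-trans : ∀ {u v w} → u ≈ v → v ≈ w → u ≈ w
  ≈-rel   : ∀ {l r} (a b : Word n) → Rel l r → (a ++ l ++ b) ≈ (a ++ r ++ b)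

infix 4 _≈_

Len : ∀ {n} → Word n → ℕ → Set
Len {n} w k = (∃ λ (u : Word n) → u ≈ w × length u ≡ k)
            × (∀ (u : Word n) → u ≈ w → k ≤ length u)

Before : ∀ {n} → Fin n → Fin n → Word n → Set
Before {n} x y u = ∃ λ (a : Word n) → ∃ λ (b : Word n) → u ≡ a ++ x ∷ b × y ∈ b

-- IsD J u : the word u is a word for d_J (each s_j, j ∈ J, exactly once,
-- with s_{j+1} left of s_j whenever j, j+1 ∈ J)
IsD : ∀ {n} → Subset n → Word n → Set
IsD J u = Unique u × (∀ j → (j ∈ₛ J) ⇔ (j ∈ u))
        × (∀ j → j ∈ₛ J → sucMod j ∈ₛ J → Before (sucMod j) j u)

-- IsU J u : the word u is a word for u_J (s_j left of s_{j+1})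
IsU : ∀ {n} → Subset n → Word n → Set
IsU J u = Unique u × (∀ j → (j ∈ₛ J) ⇔ (j ∈ u))
        × (∀ j → j ∈ₛ J → sucMod j ∈ₛ J → Before j (sucMod j) u)

RightFactor : ∀ {n} → (Subset n → Word n → Set) → Word n → Subset n → Set
RightFactor {n} IsX w J =
  J ⊂ ⊤ × (∃ λ (v : Word n) → ∃ λ (x : Word n) → IsX J x × w ≈ v ++ x ×
           (∃ λ a → ∃ λ b → Len w a × Len v b × a ≡ b + ∣ J ∣))

-- IsMax IsX w m : m is the largest |J| with RightFactor IsX w J
-- (so IsMax IsD w m means maxr(w) = m and IsMax IsU w m means maxc(w) = m)
IsMax : ∀ {n} → (Subset n → Word n → Set) → Word n → ℕ → Set
IsMax {n} IsX w m = (∃ λ (J : Subset n) → RightFactor IsX w J × ∣ J ∣ ≡ m)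
                  × (∀ (J : Subset n) → RightFactor IsX w J → ∣ J ∣ ≤ m)

MiddleFactor : ∀ {n} → (Subset n → Word n → Set) → Word n → ℕ → Set
MiddleFactor {n} IsX w q =
  ∃ λ (v₁ : Word n) → ∃ λ (v₂ : Word n) → ∃ λ (S : Subset n) → ∃ λ (x : Word n) →
    S ⊂ ⊤ × IsX S x × w ≈ v₁ ++ x ++ v₂ ×
    (∃ λ a → ∃ λ b → ∃ λ c → Len w a × Len v₁ b × Len v₂ c × a ≡ b + c + ∣ S ∣) ×
    q < ∣ S ∣

module Submission where

-- One direction is immediate (take v₂ = 1).  For the other, a word for d_S is
-- a duplicate-free "block" D in which s_{j+1} precedes s_j, and the letters of
-- a reduced word for v₂ are absorbed into D one at a time.  According to
-- whether i and i-1 occur in D, the product D s_i is a block again, equals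
-- s_{i-1} D′ for a block D′ of the same size, equals s_{i-1} D (a braid move),
-- or is two letters shorter (s_i² = 1).  The last case contradicts
-- length-additivity, so in the end w = v d_J length-additively with
-- |J| ≥ |S| > q, i.e. maxr(w) > q.

open import Defs
open import Data.Nat using (ℕ; suc; _+_; _<_; _≤_; _≤?_; _%_; z≤n; s≤s)
open import Data.Nat.DivMod
  using (_mod_; %-distribˡ-+; m%n%n≡m%n; [m+n]%n≡m%n; m<n⇒m%n≡m; m≤n⇒m%n≡m; n%n≡0)
open import Data.Nat.Properties
  using ( ≤-refl; ≤-reflexive; ≤-trans; n≤1+n; <⇒≱; <-≤-trans; ≤-antisym; ≤-pred; ≰⇒>
        ; 1+n≢n; 1+n≰n; +-cancelʳ-≤; +-comm; +-assoc; +-suc; +-identityʳ; +-monoʳ-≤)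
open import Data.Fin using (Fin; zero; suc; toℕ)
open import Data.Fin.Subset using (Subset; inside; outside; ⁅_⁆; _∪_; _-_; ∣_∣; ⊤; _⊂_)
  renaming (_∈_ to _∈ₛ_; _∉_ to _∉ₛ_; ⊥ to ⊥ₛ)
open import Data.Fin.Subset.Properties
  using ( ∈⊤; p─⊥≡p; Empty-unique; ∣⊥∣≡0; p─q⊆p; x∈p∧x≢y⇒x∈p-y; ∉⊥
        ; x∈p∪q⁻; x∈p∪q⁺; x∈⁅x⁆; x∈⁅y⁆⇒x≡y)
open import Data.Fin.Properties using (_≟_; toℕ-injective; toℕ<n; toℕ-fromℕ<)
open import Data.List using (List; []; _∷_; _++_; [_]; length)
open import Data.Vec using (_∷_; here; there)
open import Data.List.Properties using (++-assoc; ++-identityʳ; length-++; length-++-sucʳ)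
open import Function using (_∘_)
open import Data.List.Membership.Propositional using (_∈_; _∉_)
open import Data.List.Membership.Propositional.Properties using (∈-++⁺ˡ; ∈-++⁺ʳ; ∈-++⁻; ∈-∃++)
open import Data.List.Relation.Unary.Any using (here; there)
open import Data.List.Relation.Unary.All.Properties using (¬Any⇒All¬)
open import Data.List.Relation.Unary.AllPairs using ([]; _∷_)
open import Data.List.Relation.Unary.Unique.Propositional using (Unique)
open import Data.List.Relation.Unary.Unique.Propositional.Properties
  using (++⁺) renaming (Unique[x∷xs]⇒x∉xs to unique-head)
open import Data.List.Relation.Unary.Any.Properties using (¬Any[])
open import Data.Product using (∃; _×_; _,_)
open import Function.Bundles using (_⇔_; mk⇔; Equivalence)
open import Data.Sum using (inj₁; inj₂)
open import Data.Empty using (⊥-elim)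
open import Relation.Binary.Bundles using (Setoid)
open import Relation.Nullary using (yes; no)
open import Relation.Binary.PropositionalEquality
  using (_≡_; _≢_; refl; sym; trans; cong; subst; subst₂; module ≡-Reasoning)

module Congruence {n : ℕ} where

  ≡⇒≈ : {u v : Word n} → u ≡ v → u ≈ v
  ≡⇒≈ refl = ≈-refl

  word-setoid : Setoid _ _
  word-setoid = record
    { Carrier = Word n
    ; _≈_ = _≈_
    ; isEquivalence = record { refl = ≈-refl ; sym = ≈-sym ; trans = ≈-trans } }

  ≈-cong : ∀ (a b : Word n) {u v} → u ≈ v → a ++ u ++ b ≈ a ++ v ++ b
  ≈-cong a b ≈-refl = ≈-refl
  ≈-cong a b (≈-sym p) = ≈-sym (≈-cong a b p)
  ≈-cong a b (≈-trans p q) = ≈-trans (≈-cong a b p) (≈-cong a b q)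
  ≈-cong a b (≈-rel {l} {r} a′ b′ R) =
    ≈-trans (≡⇒≈ (regroup l)) (≈-trans (≈-rel (a ++ a′) (b′ ++ b) R) (≡⇒≈ (sym (regroup r))))
    where
    regroup : ∀ m → a ++ (a′ ++ m ++ b′) ++ b ≡ (a ++ a′) ++ m ++ (b′ ++ b)
    regroup m = trans (cong (a ++_) (trans (++-assoc a′ (m ++ b′) b) (cong (a′ ++_) (++-assoc m b′ b))))
                      (sym (++-assoc a a′ (m ++ b′ ++ b)))

  ≈-congˡ : ∀ (a : Word n) {u v} → u ≈ v → a ++ u ≈ a ++ v
  ≈-congˡ a {u} {v} p =
    ≈-trans (≡⇒≈ (cong (a ++_) (sym (++-identityʳ u))))
            (≈-trans (≈-cong a [] p) (≡⇒≈ (cong (a ++_) (++-identityʳ v))))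

  ≈-congʳ : ∀ (b : Word n) {u v} → u ≈ v → u ++ b ≈ v ++ b
  ≈-congʳ b = ≈-cong [] b

  LengthBound : Word n → ℕ → Set
  LengthBound w a = ∀ u → u ≈ w → a ≤ length u

  reduced-prefix : ∀ {w a} V D → LengthBound w a → w ≈ V ++ D → length V + length D ≡ a →
                   Len V (length V)
  reduced-prefix V D bound w≈ total = (V , ≈-refl , refl) , shortest
    where
    shortest : ∀ u → u ≈ V → length V ≤ length u
    shortest u u≈ = +-cancelʳ-≤ (length D) (length V) (length u)
      (subst₂ _≤_ (sym total) (length-++ u) (bound (u ++ D) (≈-trans (≈-congʳ D u≈) (≈-sym w≈))))

module DuplicateFree {A : Set} where

  unique-∷ : ∀ {x : A} {xs} → x ∉ xs → Unique xs → Unique (x ∷ xs)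
  unique-∷ x∉ u = ¬Any⇒All¬ _ x∉ ∷ u

  unique-tail : ∀ {x : A} {xs} → Unique (x ∷ xs) → Unique xs
  unique-tail (_ ∷ u) = u

  unique-notˡ : ∀ (as : List A) {x bs} → Unique (as ++ x ∷ bs) → x ∉ as
  unique-notˡ (a ∷ as) u (here refl) = unique-head u (∈-++⁺ʳ as (here refl))
  unique-notˡ (a ∷ as) u (there m) = unique-notˡ as (unique-tail u) m

  unique-notʳ : ∀ (as : List A) {x bs} → Unique (as ++ x ∷ bs) → x ∉ bs
  unique-notʳ [] u = unique-head u
  unique-notʳ (a ∷ as) u = unique-notʳ as (unique-tail u)

  unique-disjoint : ∀ (as : List A) {x bs y} → Unique (as ++ x ∷ bs) → y ∈ as → y ∉ bs
  unique-disjoint (a ∷ as) u (here refl) m = unique-head u (∈-++⁺ʳ as (there m))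
  unique-disjoint (a ∷ as) u (there p) m = unique-disjoint as (unique-tail u) p m

  unique-suffix : ∀ (as : List A) {bs} → Unique (as ++ bs) → Unique bs
  unique-suffix [] u = u
  unique-suffix (a ∷ as) u = unique-suffix as (unique-tail u)

  ∈-reinsert : ∀ (as : List A) {x bs y} → y ∈ as ++ bs → y ∈ as ++ x ∷ bs
  ∈-reinsert as m with ∈-++⁻ as m
  ... | inj₁ p = ∈-++⁺ˡ p
  ... | inj₂ p = ∈-++⁺ʳ as (there p)

  unique-deleted : ∀ (as : List A) {x bs} → Unique (as ++ x ∷ bs) → x ∉ as ++ bs
  unique-deleted as u m with ∈-++⁻ as m
  ... | inj₁ p = unique-notˡ as u p
  ... | inj₂ p = unique-notʳ as u p

  unique-delete : ∀ (as : List A) {x bs} → Unique (as ++ x ∷ bs) → Unique (as ++ bs)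
  unique-delete [] u = unique-tail u
  unique-delete (a ∷ as) u =
    unique-∷ (λ m → unique-head u (∈-reinsert as m)) (unique-delete as (unique-tail u))

  unique-snoc : ∀ (as : List A) {x} → Unique as → x ∉ as → Unique (as ++ [ x ])
  unique-snoc as u x∉ = ++⁺ u (unique-∷ (λ ()) []) λ { (m , here refl) → x∉ m }

-- Precedes x y u : some occurrence of x in u lies strictly left of some
-- occurrence of y.  An inductive form of Defs.Before, which is easier to
-- manipulate letter by letter.
module Precedence {n : ℕ} where
  open DuplicateFree {Fin n}

  data Precedes (x y : Fin n) : Word n → Set where
    now   : ∀ {u} → y ∈ u → Precedes x y (x ∷ u)
    later : ∀ {z u} → Precedes x y u → Precedes x y (z ∷ u)

  Precedes⇒Before : ∀ {x y u} → Precedes x y u → Before x y u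
  Precedes⇒Before (now {u} m) = [] , u , refl , m
  Precedes⇒Before (later {z} p) with Precedes⇒Before p
  ... | a , b , refl , m = z ∷ a , b , refl , m

  Before⇒Precedes : ∀ {x y u} → Before x y u → Precedes x y u
  Before⇒Precedes ([] , b , refl , m) = now m
  Before⇒Precedes (z ∷ a , b , refl , m) = later (Before⇒Precedes (a , b , refl , m))

  precedes-left : ∀ {x y u} → Precedes x y u → x ∈ u
  precedes-left (now _) = here refl
  precedes-left (later p) = there (precedes-left p)

  precedes-right : ∀ {x y u} → Precedes x y u → y ∈ u
  precedes-right (now m) = there m
  precedes-right (later p) = there (precedes-right p)

  precedes-++ : ∀ {x y u} v → Precedes x y u → Precedes x y (u ++ v)
  precedes-++ v (now m) = now (∈-++⁺ˡ m)
  precedes-++ v (later p) = later (precedes-++ v p)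

  precedes-last : ∀ {x y} (u : Word n) → x ∈ u → Precedes x y (u ++ [ y ])
  precedes-last (z ∷ u) (here refl) = now (∈-++⁺ʳ u (here refl))
  precedes-last (z ∷ u) (there m) = later (precedes-last u m)

  precedes-delete : ∀ {x y k} (as : Word n) {bs} → x ≢ k → y ≢ k →
                    Precedes x y (as ++ k ∷ bs) → Precedes x y (as ++ bs)
  precedes-delete [] x≢k y≢k (now m) = ⊥-elim (x≢k refl)
  precedes-delete [] x≢k y≢k (later p) = p
  precedes-delete (a ∷ as) x≢k y≢k (now m) with ∈-++⁻ as m
  ... | inj₁ p = now (∈-++⁺ˡ p)
  ... | inj₂ (here refl) = ⊥-elim (y≢k refl)
  ... | inj₂ (there p) = now (∈-++⁺ʳ as p)
  precedes-delete (a ∷ as) x≢k y≢k (later p) = later (precedes-delete as x≢k y≢k p)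

  precedes-before : ∀ (as : Word n) {x bs y} → Unique (as ++ x ∷ bs) →
                    Precedes y x (as ++ x ∷ bs) → y ∈ as
  precedes-before [] u (now m) = ⊥-elim (unique-head u m)
  precedes-before [] u (later p) = ⊥-elim (unique-head u (precedes-right p))
  precedes-before (a ∷ as) u (now m) = here refl
  precedes-before (a ∷ as) u (later p) = there (precedes-before as (unique-tail u) p)

  precedes-after : ∀ (as : Word n) {x bs y} → Unique (as ++ x ∷ bs) →
                   Precedes x y (as ++ x ∷ bs) → y ∈ bs
  precedes-after [] u (now m) = m
  precedes-after [] u (later p) = ⊥-elim (unique-head u (precedes-left p))
  precedes-after (a ∷ as) u (now m) = ⊥-elim (unique-head u (∈-++⁺ʳ as (here refl)))
  precedes-after (a ∷ as) u (later p) = precedes-after as (unique-tail u) p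

module Enumeration {n : ℕ} where
  open DuplicateFree {Fin n}

  ∣p∣≡1+∣p-x∣ : ∀ {m} (p : Subset m) x → x ∈ₛ p → ∣ p ∣ ≡ suc ∣ p - x ∣
  ∣p∣≡1+∣p-x∣ (inside ∷ p) zero here = cong (suc ∘ ∣_∣) (sym (p─⊥≡p p))
  ∣p∣≡1+∣p-x∣ (inside ∷ p) (suc x) (there m) = cong suc (∣p∣≡1+∣p-x∣ p x m)
  ∣p∣≡1+∣p-x∣ (outside ∷ p) (suc x) (there m) = ∣p∣≡1+∣p-x∣ p x m

  x∉p-x : ∀ {m} (p : Subset m) x → x ∉ₛ p - x
  x∉p-x (s ∷ p) zero ()
  x∉p-x (s ∷ p) (suc x) (there m) = x∉p-x p x m

  Enumerates : Word n → Subset n → Set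
  Enumerates D S = ∀ j → (j ∈ₛ S) ⇔ (j ∈ D)

  size-enumeration : ∀ D S → Unique D → Enumerates D S → ∣ S ∣ ≡ length D
  size-enumeration [] S u enum =
    trans (cong ∣_∣ (Empty-unique λ (j , j∈) → ¬Any[] (Equivalence.to (enum j) j∈))) (∣⊥∣≡0 n)
  size-enumeration (x ∷ D) S u enum =
    trans (∣p∣≡1+∣p-x∣ S x (Equivalence.from (enum x) (here refl)))
          (cong suc (size-enumeration D (S - x) (unique-tail u) (λ j → mk⇔ (to j) (from j))))
    where
    to : ∀ j → j ∈ₛ S - x → j ∈ D
    to j j∈ with Equivalence.to (enum j) (p─q⊆p S ⁅ x ⁆ j∈)
    ... | here refl = ⊥-elim (x∉p-x S x j∈)
    ... | there m = m
    from : ∀ j → j ∈ D → j ∈ₛ S - x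
    from j m = x∈p∧x≢y⇒x∈p-y (Equivalence.from (enum j) (there m))
                             (λ { refl → unique-head u m })

  fromList : Word n → Subset n
  fromList [] = ⊥ₛ
  fromList (x ∷ D) = ⁅ x ⁆ ∪ fromList D

  enumerates-fromList : ∀ D → Enumerates D (fromList D)
  enumerates-fromList D j = mk⇔ (to D) (from D)
    where
    to : ∀ D → j ∈ₛ fromList D → j ∈ D
    to [] j∈ = ⊥-elim (∉⊥ j∈)
    to (x ∷ D) j∈ with x∈p∪q⁻ ⁅ x ⁆ (fromList D) j∈
    ... | inj₁ p = here (x∈⁅y⁆⇒x≡y x p)
    ... | inj₂ p = there (to D p)
    from : ∀ D → j ∈ D → j ∈ₛ fromList D
    from (x ∷ D) (here refl) = x∈p∪q⁺ (inj₁ (x∈⁅x⁆ x))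
    from (x ∷ D) (there m) = x∈p∪q⁺ (inj₂ (from D m))

module LengthArithmetic where

  lengths-absorbed : ∀ v p d′ d r {a} → p + d′ ≡ suc d → v + (d + suc r) ≡ a →
                     (v + p) + (d′ + r) ≡ a
  lengths-absorbed v p d′ d r grows total = begin
    (v + p) + (d′ + r)  ≡⟨ +-assoc v p (d′ + r) ⟩
    v + (p + (d′ + r))  ≡⟨ cong (v +_) (+-assoc p d′ r) ⟨
    v + ((p + d′) + r)  ≡⟨ cong (λ t → v + (t + r)) grows ⟩
    v + (suc d + r)     ≡⟨ cong (v +_) (+-suc d r) ⟨
    v + (d + suc r)     ≡⟨ total ⟩
    _                   ∎
    where open ≡-Reasoning

  regroup-middle : ∀ b x c {s a} → s ≡ x → a ≡ b + c + s → b + (x + c) ≡ a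
  regroup-middle b x c refl refl = begin
    b + (x + c)  ≡⟨ cong (b +_) (+-comm x c) ⟩
    b + (c + x)  ≡⟨ +-assoc b c x ⟨
    b + c + x    ∎
    where open ≡-Reasoning

  lengths-cancelled : ∀ v e d r {a} → suc e ≡ d → v + (d + suc r) ≡ a → v + (e + r) < a
  lengths-cancelled v e d r refl refl =
    subst (_≤ v + (suc e + suc r)) (+-suc v (e + r))
          (+-monoʳ-≤ v (s≤s (+-monoʳ-≤ e (n≤1+n r))))

-- For d_J the
-- neighbour of j is j+1, for u_J it is j-1: a word for d_J (resp. u_J) is a
-- duplicate-free word in which σ j precedes j whenever both occur.
module Blocks {n : ℕ} (σ τ : Fin n → Fin n)
  (σ∘τ : ∀ i → σ (τ i) ≡ i) (τ∘σ : ∀ i → τ (σ i) ≡ i) (σ-no-fixpoint : ∀ k → σ k ≢ k)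
  (commute : ∀ x y → x ≢ σ y → y ≢ σ x → x ∷ y ∷ [] ≈ y ∷ x ∷ [])
  (braid : ∀ k → k ∷ σ k ∷ k ∷ [] ≈ σ k ∷ k ∷ σ k ∷ [])
  where

  open Congruence {n}
  open DuplicateFree {Fin n}
  open Precedence {n}
  open LengthArithmetic
  open Enumeration {n}
  open import Relation.Binary.Reasoning.Setoid word-setoid
  open import Data.List.Membership.DecPropositional (_≟_ {n}) using (_∈?_)

  -- s_x and s_y commute
  Apart : Fin n → Fin n → Set
  Apart x y = x ≢ σ y × y ≢ σ x

  Ordered : Word n → Set
  Ordered D = ∀ j → j ∈ D → σ j ∈ D → Precedes (σ j) j D

  -- a block is a word for d_J / u_J with J a proper subset
  Block : Word n → Set
  Block D = Unique D × Ordered D × ∃ (λ k → k ∉ D)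

  τ-no-fixpoint : ∀ i → τ i ≢ i
  τ-no-fixpoint i e = σ-no-fixpoint i (trans (cong σ (sym e)) (σ∘τ i))

  σ⇒τ : ∀ {j i} → σ j ≡ i → j ≡ τ i
  σ⇒τ {j} e = trans (sym (τ∘σ j)) (cong τ e)

  slide : ∀ x B rest → (∀ b → b ∈ B → Apart x b) → x ∷ B ++ rest ≈ B ++ x ∷ rest
  slide x [] rest apart = ≈-refl
  slide x (b ∷ B) rest apart with apart b (here refl)
  ... | x≢σb , b≢σx =
    ≈-trans (≈-congʳ (B ++ rest) (commute x b x≢σb b≢σx))
            (≈-congˡ [ b ] (slide x B rest (λ c m → apart c (there m))))

  slide-end : ∀ x B → (∀ b → b ∈ B → Apart x b) → x ∷ B ≈ B ++ [ x ]
  slide-end x B apart =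
    ≈-trans (≡⇒≈ (cong (x ∷_) (sym (++-identityʳ B)))) (slide x B [] apart)

  apart-after : ∀ as {x bs b} → Unique (as ++ x ∷ bs) → Ordered (as ++ x ∷ bs) →
                b ∈ bs → b ≢ τ x → Apart x b
  apart-after as {x} u o b∈ b≢τx =
      (λ e → b≢τx (σ⇒τ (sym e)))
    , (λ e → unique-disjoint as u
               (precedes-before as u (o x (∈-++⁺ʳ as (here refl)) (subst (_∈ _) e later-b)))
               (subst (_∈ _) e b∈))
    where later-b = ∈-++⁺ʳ as (there b∈)

  apart-before : ∀ as {x bs a} → Unique (as ++ x ∷ bs) → Ordered (as ++ x ∷ bs) →
                 a ∈ as → a ≢ σ x → Apart x a
  apart-before as {x} u o a∈ a≢σx =
      (λ e → unique-disjoint as u a∈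
               (precedes-after as u (subst (λ z → Precedes z _ _) (sym e)
                 (o _ (∈-++⁺ˡ a∈) (subst (_∈ _) e (∈-++⁺ʳ as (here refl)))))))
    , a≢σx

  ordered-snoc : ∀ D {i} → Ordered D → τ i ∉ D → Ordered (D ++ [ i ])
  ordered-snoc D o τi∉ j j∈ σj∈ with ∈-++⁻ D j∈ | ∈-++⁻ D σj∈
  ... | inj₁ p | inj₁ q = precedes-++ _ (o j p q)
  ... | inj₁ p | inj₂ (here e) = ⊥-elim (τi∉ (subst (_∈ D) (σ⇒τ e) p))
  ... | inj₂ (here refl) | inj₁ q = precedes-last D q
  ... | inj₂ (here refl) | inj₂ (here e) = ⊥-elim (σ-no-fixpoint j e)

  ordered-delete : ∀ as {k bs} → Unique (as ++ k ∷ bs) → Ordered (as ++ k ∷ bs) →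
                   Ordered (as ++ bs)
  ordered-delete as u o j j∈ σj∈ =
    precedes-delete as (λ e → k∉ (subst (_∈ _) e σj∈)) (λ e → k∉ (subst (_∈ _) e j∈))
                    (o j (∈-reinsert as j∈) (∈-reinsert as σj∈))
    where k∉ = unique-deleted as u

  snoc-block : ∀ D {i} → Unique D → Ordered D → i ∉ D → τ i ∉ D → Block (D ++ [ i ])
  snoc-block D {i} u o i∉ τi∉ = unique-snoc D u i∉ , ordered-snoc D o τi∉ , τ i , τi∉′
    where
    τi∉′ : τ i ∉ D ++ [ i ]
    τi∉′ m with ∈-++⁻ D m
    ... | inj₁ p = τi∉ p
    ... | inj₂ (here e) = τ-no-fixpoint i e

  length-snoc : ∀ (D : Word n) i → length (D ++ [ i ]) ≡ suc (length D)
  length-snoc D i = trans (length-++-sucʳ D i []) (cong (suc ∘ length) (++-identityʳ D))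

  pull-to-front : ∀ as {k bs} → Unique (as ++ k ∷ bs) → Ordered (as ++ k ∷ bs) →
                  σ k ∉ as → as ++ k ∷ bs ≈ k ∷ as ++ bs
  pull-to-front as u o σk∉ =
    ≈-sym (slide _ as _ (λ a a∈ → apart-before as u o a∈ (λ e → σk∉ (subst (_∈ as) e a∈))))

  push-to-back : ∀ as {i bs} → Unique (as ++ i ∷ bs) → Ordered (as ++ i ∷ bs) →
                 τ i ∉ bs → as ++ i ∷ bs ≈ as ++ bs ++ [ i ]
  push-to-back as u o τi∉ =
    ≈-congˡ as (slide-end _ _ (λ b b∈ → apart-after as u o b∈ (λ e → τi∉ (subst (_∈ _) e b∈))))

  -- Writing D = as (σ k) bs k ds, the letter σ k slides past ds and bs, the
  -- braid relation turns (σ k) k (σ k) into k (σ k) k, then k slides to the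
  -- front and σ k slides back past bs.
  braid-absorb : ∀ D {k} → Unique D → Ordered D → σ k ∈ D → k ∈ D → D ++ [ σ k ] ≈ k ∷ D
  braid-absorb D {k} u o σk∈ k∈ with ∈-∃++ σk∈
  ... | as , cs , refl with ∈-∃++ (precedes-after as u (o k k∈ σk∈))
  ... | bs , ds , refl = begin
      (as ++ σ k ∷ bs ++ k ∷ ds) ++ [ σ k ]
    ≡⟨ trans (++-assoc as _ [ σ k ]) (cong (λ t → as ++ σ k ∷ t) (++-assoc bs (k ∷ ds) [ σ k ])) ⟩
      as ++ σ k ∷ bs ++ k ∷ ds ++ [ σ k ]
    ≈⟨ ≈-congˡ as (≈-congˡ (σ k ∷ bs) (≈-congˡ [ k ] (≈-sym (slide-end (σ k) ds σk-ds)))) ⟩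
      as ++ σ k ∷ bs ++ k ∷ σ k ∷ ds
    ≈⟨ ≈-congˡ as (slide (σ k) bs _ σk-bs) ⟩
      as ++ bs ++ σ k ∷ k ∷ σ k ∷ ds
    ≈⟨ ≈-congˡ as (≈-congˡ bs (≈-congʳ ds (≈-sym (braid k)))) ⟩
      as ++ bs ++ k ∷ σ k ∷ k ∷ ds
    ≡⟨ ++-assoc as bs _ ⟨
      (as ++ bs) ++ k ∷ σ k ∷ k ∷ ds
    ≈⟨ slide k (as ++ bs) _ k-asbs ⟨
      k ∷ (as ++ bs) ++ σ k ∷ k ∷ ds
    ≡⟨ cong (k ∷_) (++-assoc as bs _) ⟩
      k ∷ as ++ bs ++ σ k ∷ k ∷ ds
    ≈⟨ ≈-congˡ (k ∷ as) (slide (σ k) bs _ σk-bs) ⟨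
      k ∷ as ++ σ k ∷ bs ++ k ∷ ds
    ∎
    where
    u-tail : Unique (bs ++ k ∷ ds)
    u-tail = unique-tail (unique-suffix as u)
    σk-later : ∀ {b} → b ∈ bs ++ k ∷ ds → b ≢ k → Apart (σ k) b
    σk-later b∈ b≢k = apart-after as u o b∈ (λ e → b≢k (trans e (τ∘σ k)))
    σk-bs : ∀ b → b ∈ bs → Apart (σ k) b
    σk-bs b b∈ = σk-later (∈-++⁺ˡ b∈) (λ e → unique-notˡ bs u-tail (subst (_∈ bs) e b∈))
    σk-ds : ∀ d → d ∈ ds → Apart (σ k) d
    σk-ds d d∈ = σk-later (∈-++⁺ʳ bs (there d∈)) (λ e → unique-notʳ bs u-tail (subst (_∈ ds) e d∈))
    regroup : as ++ σ k ∷ bs ++ k ∷ ds ≡ (as ++ σ k ∷ bs) ++ k ∷ ds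
    regroup = sym (++-assoc as (σ k ∷ bs) (k ∷ ds))
    σk∉ : σ k ∉ as ++ bs
    σk∉ m with ∈-++⁻ as m
    ... | inj₁ p = unique-notˡ as u p
    ... | inj₂ p = unique-notʳ as u (∈-++⁺ˡ p)
    k-asbs : ∀ a → a ∈ as ++ bs → Apart k a
    k-asbs a a∈ = apart-before (as ++ σ k ∷ bs) (subst Unique regroup u) (subst Ordered regroup o)
                    (∈-reinsert as a∈) (λ e → σk∉ (subst (_∈ _) e a∈))

  data Absorption (D : Word n) (i : Fin n) : Set where
    absorbed  : (P D′ : Word n) → D ++ [ i ] ≈ P ++ D′ → Block D′ →
                length P + length D′ ≡ suc (length D) → length D ≤ length D′ → Absorption D i
    cancelled : (E : Word n) → D ++ [ i ] ≈ E → suc (length E) ≡ length D → Absorption D i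

  absorb-shift : ∀ D {i} → Unique D → Ordered D → i ∉ D → τ i ∈ D → Absorption D i
  absorb-shift D {i} u o i∉ τi∈ with ∈-∃++ τi∈
  ... | as , bs , refl =
    absorbed [ τ i ] ((as ++ bs) ++ [ i ]) moved
      (snoc-block (as ++ bs) (unique-delete as u) (ordered-delete as u o)
                  (λ m → i∉ (∈-reinsert as m)) (unique-deleted as u))
      (cong suc (sym same-length)) (≤-reflexive same-length)
    where
    moved : (as ++ τ i ∷ bs) ++ [ i ] ≈ τ i ∷ (as ++ bs) ++ [ i ]
    moved = ≈-congʳ [ i ] (pull-to-front as u o
              (λ m → i∉ (∈-++⁺ˡ (subst (_∈ as) (σ∘τ i) m))))
    same-length : length (as ++ τ i ∷ bs) ≡ length ((as ++ bs) ++ [ i ])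
    same-length = trans (length-++-sucʳ as (τ i) bs) (sym (length-snoc (as ++ bs) i))

  absorb-cancel : ∀ D {i} → Unique D → Ordered D → i ∈ D → τ i ∉ D → Absorption D i
  absorb-cancel D {i} u o i∈ τi∉ with ∈-∃++ i∈
  ... | as , bs , refl = cancelled (as ++ bs) cancel (sym (length-++-sucʳ as i bs))
    where
    cancel : (as ++ i ∷ bs) ++ [ i ] ≈ as ++ bs
    cancel = begin
        (as ++ i ∷ bs) ++ [ i ]
      ≈⟨ ≈-congʳ [ i ] (push-to-back as u o (λ m → τi∉ (∈-++⁺ʳ as (there m)))) ⟩
        (as ++ bs ++ [ i ]) ++ [ i ]
      ≡⟨ trans (++-assoc as (bs ++ [ i ]) [ i ]) (cong (as ++_) (++-assoc bs [ i ] [ i ])) ⟩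
        as ++ bs ++ i ∷ i ∷ []
      ≈⟨ ≈-congˡ as (≈-congˡ bs (≈-rel [] [] (quad i))) ⟩
        as ++ bs ++ []
      ≡⟨ cong (as ++_) (++-identityʳ bs) ⟩
        as ++ bs
      ∎

  absorb-letter : ∀ D i → Block D → Absorption D i
  absorb-letter D i (u , o , proper) with i ∈? D | τ i ∈? D
  ... | no i∉ | no τi∉ =
    absorbed [] (D ++ [ i ]) ≈-refl (snoc-block D u o i∉ τi∉)
             (length-snoc D i) (subst (length D ≤_) (sym (length-snoc D i)) (n≤1+n _))
  ... | no i∉ | yes τi∈ = absorb-shift D u o i∉ τi∈
  ... | yes i∈ | no τi∉ = absorb-cancel D u o i∈ τi∉
  ... | yes i∈ | yes τi∈ =
    absorbed [ τ i ] D (subst (λ z → D ++ [ z ] ≈ τ i ∷ D) (σ∘τ i)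
                          (braid-absorb D u o (subst (_∈ D) (sym (σ∘τ i)) i∈) τi∈))
             (u , o , proper) refl ≤-refl

  record RightBlock (w : Word n) (a k : ℕ) : Set where
    constructor rightBlock
    field
      prefix block  : Word n
      is-block      : Block block
      factorisation : w ≈ prefix ++ block
      lengths       : length prefix + length block ≡ a
      large         : k ≤ length block

  replace-product : ∀ {w} V D i R Z → w ≈ V ++ D ++ i ∷ R → D ++ [ i ] ≈ Z → w ≈ V ++ Z ++ R
  replace-product {w} V D i R Z w≈ moved = begin
      w                       ≈⟨ w≈ ⟩
      V ++ D ++ [ i ] ++ R    ≡⟨ cong (V ++_) (++-assoc D [ i ] R) ⟨
      V ++ (D ++ [ i ]) ++ R  ≈⟨ ≈-cong V R moved ⟩
      V ++ Z ++ R             ∎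

  -- Absorb the letters of R one by one into the block D.  In a length-additive
  -- factorisation w = V · D · R no cancellation can occur, so every letter is
  -- absorbed and the block never shrinks.
  absorb-suffix : ∀ {w a} → LengthBound w a → ∀ R V D → Block D → w ≈ V ++ D ++ R →
                  length V + (length D + length R) ≡ a → RightBlock w a (length D)
  absorb-suffix bound [] V D blk w≈ len =
    rightBlock V D blk (≈-trans w≈ (≡⇒≈ (cong (V ++_) (++-identityʳ D))))
               (trans (cong (length V +_) (sym (+-identityʳ (length D)))) len) ≤-refl
  absorb-suffix bound (i ∷ R) V D blk w≈ len with absorb-letter D i blk
  ... | absorbed P D′ moved blk′ grows longer =
    let rightBlock V′ D″ blk″ w≈′ len′ larger =
          absorb-suffix bound R (V ++ P) D′ blk′
            (≈-trans (replace-product V D i R (P ++ D′) w≈ moved) (≡⇒≈ regroup))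
            (trans (cong (_+ _) (length-++ V))
              (lengths-absorbed (length V) (length P) (length D′) (length D) (length R) grows len))
    in rightBlock V′ D″ blk″ w≈′ len′ (≤-trans longer larger)
    where
    regroup : V ++ (P ++ D′) ++ R ≡ (V ++ P) ++ D′ ++ R
    regroup = trans (cong (V ++_) (++-assoc P D′ R)) (sym (++-assoc V P (D′ ++ R)))
  ... | cancelled E moved shrinks =
    ⊥-elim (<⇒≱ (lengths-cancelled (length V) (length E) (length D) (length R) shrinks len)
                (subst (_ ≤_) (length-++³ V E R)
                   (bound _ (≈-sym (replace-product V D i R E w≈ moved)))))
    where
    length-++³ : ∀ (V E R : Word n) → length (V ++ E ++ R) ≡ length V + (length E + length R)
    length-++³ V E R = trans (length-++ V) (cong (length V +_) (length-++ E))

  module Factorisations (IsX : Subset n → Word n → Set)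
    (to-block : ∀ {J x} → IsX J x → Unique x × Enumerates x J × Ordered x)
    (from-block : ∀ {J x} → Unique x → Enumerates x J → Ordered x → IsX J x)
    where

    middle⇒right : ∀ {w q} → MiddleFactor IsX w q → ∃ λ J → RightFactor IsX w J × q < ∣ J ∣
    middle⇒right {w} (v₁ , v₂ , S , x , (_ , k , _ , k∉S) , isX , w≈ ,
                          (a , _ , _ , Lw@(_ , bound) , ((u₁ , u₁≈ , refl) , _) ,
                           ((u₂ , u₂≈ , refl) , _) , a≡) , q<S)
      with to-block isX
    ... | u , enum , o
      with absorb-suffix bound u₂ u₁ x (u , o , k , λ m → k∉S (Equivalence.from (enum k) m))
                         w≈u₁xu₂ total
      where
      w≈u₁xu₂ : w ≈ u₁ ++ x ++ u₂
      w≈u₁xu₂ = ≈-trans w≈ (≈-trans (≈-congʳ (x ++ v₂) (≈-sym u₁≈))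
                                    (≈-congˡ u₁ (≈-congˡ x (≈-sym u₂≈))))
      total : length u₁ + (length x + length u₂) ≡ a
      total = regroup-middle (length u₁) (length x) (length u₂) (size-enumeration x S u enum) a≡
    ... | rightBlock V D (uD , oD , k′ , k′∉) w≈′ lengths larger =
      J , (proper , V , D , from-block uD enumJ oD , w≈′ , a , length V , Lw ,
           reduced-prefix V D bound w≈′ lengths , trans (sym lengths) (cong (length V +_) (sym ∣J∣))) ,
      <-≤-trans q<S (subst₂ _≤_ (sym (size-enumeration x S u enum)) (sym ∣J∣) larger)
      where
      J : Subset n
      J = fromList D
      enumJ : Enumerates D J
      enumJ = enumerates-fromList D
      ∣J∣ : ∣ J ∣ ≡ length D
      ∣J∣ = size-enumeration D J uD enumJ
      proper : J ⊂ ⊤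
      proper = (λ _ → ∈⊤) , k′ , ∈⊤ , λ m → k′∉ (Equivalence.to (enumJ k′) m)

max-criterion : ∀ {n} (IsX : Subset n → Word n → Set) →
                (∀ {w q} → MiddleFactor IsX w q → ∃ λ J → RightFactor IsX w J × q < ∣ J ∣) →
                ∀ w q m → IsMax IsX w m → (q < m ⇔ MiddleFactor IsX w q)
max-criterion IsX middle⇒right w q m
              ((J , (J⊂ , v , x , isX , w≈ , a , b , Lw , Lv , a≡) , ∣J∣≡m) , maximal) =
  mk⇔ right⇒middle middle⇒max
  where
  open Congruence
  empty-length : Len [] 0
  empty-length = ([] , ≈-refl , refl) , λ _ _ → z≤n
  right⇒middle : q < m → MiddleFactor IsX w q
  right⇒middle q<m =
    v , [] , J , x , J⊂ , isX , ≈-trans w≈ (≡⇒≈ (cong (v ++_) (sym (++-identityʳ x)))) ,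
    (a , b , 0 , Lw , Lv , empty-length , trans a≡ (cong (_+ ∣ J ∣) (sym (+-identityʳ b)))) ,
    subst (q <_) (sym ∣J∣≡m) q<m
  middle⇒max : MiddleFactor IsX w q → q < m
  middle⇒max mf = let (J′ , right , q<J′) = middle⇒right mf in <-≤-trans q<J′ (maximal J′ right)

module Cyclic (m : ℕ) where

  -- j ↦ j - 1, computed as j + m
  predMod : Fin (suc m) → Fin (suc m)
  predMod i = (toℕ i + m) mod suc m

  toℕ-mod : ∀ a → toℕ (a mod suc m) ≡ a % suc m
  toℕ-mod a = toℕ-fromℕ< _

  %-absorb : ∀ a b → (a + b % suc m) % suc m ≡ (a + b) % suc m
  %-absorb a b = begin
    (a + b % suc m) % suc m                        ≡⟨ %-distribˡ-+ a (b % suc m) (suc m) ⟩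
    (a % suc m + b % suc m % suc m) % suc m        ≡⟨ cong (λ t → (a % suc m + t) % suc m) (m%n%n≡m%n b (suc m)) ⟩
    (a % suc m + b % suc m) % suc m                ≡⟨ %-distribˡ-+ a b (suc m) ⟨
    (a + b) % suc m                                ∎
    where open ≡-Reasoning

  +suc-m : ∀ (i : Fin (suc m)) → (toℕ i + suc m) % suc m ≡ toℕ i
  +suc-m i = trans ([m+n]%n≡m%n (toℕ i) (suc m)) (m<n⇒m%n≡m (toℕ<n i))

  sucMod∘predMod : ∀ i → sucMod (predMod i) ≡ i
  sucMod∘predMod i = toℕ-injective (begin
    toℕ (sucMod (predMod i))            ≡⟨ toℕ-mod (suc (toℕ (predMod i))) ⟩
    suc (toℕ (predMod i)) % suc m       ≡⟨ cong (λ t → suc t % suc m) (toℕ-mod (toℕ i + m)) ⟩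
    (1 + (toℕ i + m) % suc m) % suc m   ≡⟨ %-absorb 1 (toℕ i + m) ⟩
    suc (toℕ i + m) % suc m             ≡⟨ cong (_% suc m) (+-suc (toℕ i) m) ⟨
    (toℕ i + suc m) % suc m             ≡⟨ +suc-m i ⟩
    toℕ i                               ∎)
    where open ≡-Reasoning

  predMod∘sucMod : ∀ i → predMod (sucMod i) ≡ i
  predMod∘sucMod i = toℕ-injective (begin
    toℕ (predMod (sucMod i))                ≡⟨ toℕ-mod (toℕ (sucMod i) + m) ⟩
    (toℕ (sucMod i) + m) % suc m            ≡⟨ cong (λ t → (t + m) % suc m) (toℕ-mod (suc (toℕ i))) ⟩
    (suc (toℕ i) % suc m + m) % suc m       ≡⟨ cong (_% suc m) (+-comm _ m) ⟩
    (m + suc (toℕ i) % suc m) % suc m       ≡⟨ %-absorb m (suc (toℕ i)) ⟩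
    (m + suc (toℕ i)) % suc m               ≡⟨ cong (_% suc m) (trans (+-comm m _) (sym (+-suc (toℕ i) m))) ⟩
    (toℕ i + suc m) % suc m                 ≡⟨ +suc-m i ⟩
    toℕ i                                   ∎)
    where open ≡-Reasoning

  sucMod-no-fixpoint : 1 ≤ m → ∀ k → sucMod k ≢ k
  sucMod-no-fixpoint 1≤m k e with suc (toℕ k) ≤? m
  ... | yes k<m = 1+n≢n (trans (sym (m≤n⇒m%n≡m k<m)) (trans (sym (toℕ-mod (suc (toℕ k)))) (cong toℕ e)))
  ... | no k≮m = 1+n≰n (subst (1 ≤_) m≡0 1≤m)
    where
    k≡m : toℕ k ≡ m
    k≡m = ≤-antisym (≤-pred (toℕ<n k)) (≤-pred (≰⇒> k≮m))
    m≡0 : m ≡ 0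
    m≡0 = begin
      m                        ≡⟨ k≡m ⟨
      toℕ k                    ≡⟨ cong toℕ e ⟨
      toℕ (sucMod k)           ≡⟨ toℕ-mod (suc (toℕ k)) ⟩
      suc (toℕ k) % suc m      ≡⟨ cong (λ t → suc t % suc m) k≡m ⟩
      suc m % suc m            ≡⟨ n%n≡0 (suc m) ⟩
      0                        ∎
      where open ≡-Reasoning

  predMod-no-fixpoint : 1 ≤ m → ∀ k → predMod k ≢ k
  predMod-no-fixpoint 1≤m k e =
    sucMod-no-fixpoint 1≤m k (trans (cong sucMod (sym e)) (sucMod∘predMod k))

module AffineBlocks (m : ℕ) (1≤m : 1 ≤ m) where
  open Cyclic m
  open Precedence {suc m}
  open Enumeration {suc m}
  open Equivalence

  module D = Blocks sucMod predMod sucMod∘predMod predMod∘sucMod (sucMod-no-fixpoint 1≤m)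
               (λ x y x≢σy y≢σx → ≈-rel [] [] (comm x y y≢σx x≢σy))
               (λ k → ≈-rel [] [] (braid k))

  commute-pred : ∀ x y → x ≢ predMod y → y ≢ predMod x → x ∷ y ∷ [] ≈ y ∷ x ∷ []
  commute-pred x y x≢py y≢px = ≈-rel [] [] (comm x y (λ e → x≢py (adjacent e)) (λ e → y≢px (adjacent e)))
    where
    adjacent : ∀ {a b} → b ≡ sucMod a → a ≡ predMod b
    adjacent {a} e = trans (sym (predMod∘sucMod a)) (cong predMod (sym e))

  braid-pred : ∀ k → k ∷ predMod k ∷ k ∷ [] ≈ predMod k ∷ k ∷ predMod k ∷ []
  braid-pred k = ≈-sym (subst (λ z → predMod k ∷ z ∷ predMod k ∷ [] ≈ z ∷ predMod k ∷ z ∷ [])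
                              (sucMod∘predMod k) (≈-rel [] [] (braid (predMod k))))

  module U = Blocks predMod sucMod predMod∘sucMod sucMod∘predMod (predMod-no-fixpoint 1≤m)
               commute-pred braid-pred

  d-middle⇒right : ∀ {w q} → MiddleFactor IsD w q → ∃ λ J → RightFactor IsD w J × q < ∣ J ∣
  d-middle⇒right = D.Factorisations.middle⇒right IsD to-block from-block
    where
    to-block : ∀ {J x} → IsD J x → Unique x × Enumerates x J × D.Ordered x
    to-block (u , enum , before) =
      u , enum , λ j j∈ σj∈ → Before⇒Precedes (before j (from (enum j) j∈) (from (enum _) σj∈))
    from-block : ∀ {J x} → Unique x → Enumerates x J → D.Ordered x → IsD J x
    from-block u enum o =
      u , enum , λ j j∈ σj∈ → Precedes⇒Before (o j (to (enum j) j∈) (to (enum _) σj∈))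

  u-middle⇒right : ∀ {w q} → MiddleFactor IsU w q → ∃ λ J → RightFactor IsU w J × q < ∣ J ∣
  u-middle⇒right = U.Factorisations.middle⇒right IsU to-block from-block
    where
    to-block : ∀ {J x} → IsU J x → Unique x × Enumerates x J × U.Ordered x
    to-block {x = x} (u , enum , before) = u , enum , λ j j∈ pj∈ →
      subst (λ z → Precedes (predMod j) z x) (sucMod∘predMod j)
        (Before⇒Precedes (before (predMod j) (from (enum _) pj∈)
          (from (enum _) (subst (_∈ x) (sym (sucMod∘predMod j)) j∈))))
    from-block : ∀ {J x} → Unique x → Enumerates x J → U.Ordered x → IsU J x
    from-block {x = x} u enum o = u , enum , λ j j∈ sj∈ →
      Precedes⇒Before (subst (λ z → Precedes z (sucMod j) x) (predMod∘sucMod j)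
        (o (sucMod j) (to (enum _) sj∈) (subst (_∈ x) (sym (predMod∘sucMod j)) (to (enum j) j∈))))

lemma3 : (n : ℕ) → 3 ≤ n → (w : Word n) → (q : ℕ) → 1 ≤ q → q < n →
    (∀ m → IsMax IsD w m → (q < m ⇔ MiddleFactor IsD w q))
    × (∀ m → IsMax IsU w m → (q < m ⇔ MiddleFactor IsU w q))
lemma3 (suc (suc (suc k))) (s≤s (s≤s (s≤s z≤n))) w q _ _ =
  max-criterion IsD d-middle⇒right w q , max-criterion IsU u-middle⇒right w q
  where open AffineBlocks (suc (suc k)) (s≤s z≤n)
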